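{- Let $G=(B,G_1,\dots,G_k)$ be a BAB-graph having at least one Sachs subgraph. Then $\mathrm{def}(G)=\mathrm{def}(B)+k$.
   Context: All graphs are finite and simple. For a graph $H$, $\mathrm{def}(H)=|V(H)|-2\mu(H)$ is the number of vertices left uncovered by a maximum matching ($\mathrm{def}$ of the empty graph is $0$). A Sachs subgraph of a graph is a spanning subgraph each of whose connected components is either a single edge or a cycle. For a graph $H$, the Gallai–Edmonds sets are: $D(H)$ is the set of vertices $v$ such that some maximum matching of $H$ does not cover $v$; $A(H)$ is the set of vertices not in $D(H)$ that are adjacent to some vertex of $D(H)$; and $C(H)=V(H)\setminus(D(H)\cup A(H))$. A graph is almost bipartite if it contains exactly one odd cycle. It is König–Egerváry if $\alpha(H)+\mu(H)=|V(H)|$. Let $M$ be a matching of $H$. An $M$-blossom is an odd cycle of length $2t+1$ containing exactly $t$ edges of $M$; its base is the vertex of the cycle not covered by the $M$-edges of the cycle. An $M$-stem is an $M$-alternating path of even length (possibly $0$) from the base to a vertex not covered by $M$, sharing only the base with the blossom. An $M$-flower is the union of a blossom and a stem. BAB-graph: let $B$ be a bipartite graph (possibly empty) and $G_1,\dots,G_k$ graphs, all pairwise vertex-disjoint, where each $G_i$ is an almost bipartite non-König–Egerváry graph with unique odd cycle $C_i$, such that every vertex of $G_i$ lies in some $M$-flower of $G_i$ with blossom $C_i$ for some maximum matching $M$ of $G_i$. The graph $G$ is obtained from $B\cup G_1\cup\dots\cup G_k$ by adding edges, each joining vertices of two different graphs among $B,G_1,\dots,G_k$, such that every vertex of $B$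 incident with an added edge lies in $A(B)\cup C(B)$, and every vertex of $G_i$ incident with an added edge lies in $A(G_i)$. It is denoted $(B,G_1,\dots,G_k)$. -}

module Defs where

open import Data.Nat using (ℕ; zero; suc; _+_; _*_; _≤_)
open import Data.Fin using (Fin) renaming (_≟_ to _≟F_)
open import Data.Bool using (Bool; true; false; _∧_; not)
open import Data.Maybe using (Maybe; just; nothing; is-nothing; is-just)
open import Data.Maybe.Properties using (≡-dec)
open import Data.List using (List; []; _∷_; _++_; [_]; length; filterᵇ; allFin; lookup)
open import Data.List.Membership.Propositional using (_∈_; _∉_)
open import Data.List.Relation.Unary.Unique.Propositional using (Unique)
open import Data.Product using (Σ; ∃; _×_; _,_; uncurry)
open import Data.Sum using (_⊎_)
open import Data.Unit using (⊤)
open import Relation.Nullary using (¬_; does)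
open import Relation.Binary.PropositionalEquality using (_≡_; _≢_)

record Graph (n : ℕ) : Set where
  field
    adj     : Fin n → Fin n → Bool
    adj-sym : ∀ u v → adj u v ≡ adj v u
    adj-irr : ∀ v → adj v v ≡ false
open Graph public

VSet : ℕ → Set
VSet n = Fin n → Bool

allV : ∀ {n} → VSet n
allV _ = true

countB : ∀ {n} → (Fin n → Bool) → ℕ
countB {n} f = length (filterᵇ f (allFin n))

lastOf : ∀ {A : Set} → A → List A → A
lastOf x []       = x
lastOf x (y ∷ ys) = lastOf y ys

pairs : ∀ {A : Set} → List A → List (A × A)
pairs []           = []
pairs (x ∷ [])     = []
pairs (x ∷ y ∷ ys) = (x , y) ∷ pairs (y ∷ ys)

-- All notions below are for the induced subgraph H = G[S].
module _ {n : ℕ} (G : Graph n) (S : VSet n) where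

  Edge : Fin n → Fin n → Set
  Edge u v = (S u ≡ true) × (S v ≡ true) × (adj G u v ≡ true)

  Chain : List (Fin n) → Set
  Chain []           = ⊤
  Chain (x ∷ [])     = ⊤
  Chain (x ∷ y ∷ ys) = Edge x y × Chain (y ∷ ys)

  record Cycle : Set where
    field
      start    : Fin n
      rest     : List (Fin n)
      long     : 2 ≤ length rest
      distinct : Unique (start ∷ rest)
      chain    : Chain (start ∷ rest)
      close    : Edge (lastOf start rest) start

  record Matching : Set where
    field
      mate  : Fin n → Maybe (Fin n)
      valid : ∀ u v → mate u ≡ just v →
              Edge u v × (mate v ≡ just u)

  -- twice the number of edges of the matching
  size2 : Matching → ℕ
  size2 M = countB (λ v → is-just (Matching.mate M v))

  uncovered : Matching → ℕ
  uncovered M = countB (λ v → S v ∧ is-nothing (Matching.mate M v))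

  IsMaximum : Matching → Set
  IsMaximum M = ∀ (M' : Matching) → size2 M' ≤ size2 M

  -- def(H) = d : d = |V(H)| - 2 μ(H), i.e. d is the number of vertices
  -- uncovered by a maximum matching
  HasDef : ℕ → Set
  HasDef d = Σ Matching λ M → IsMaximum M × (uncovered M ≡ d)

  InD : Fin n → Set
  InD v = (S v ≡ true) × Σ Matching λ M → IsMaximum M × (Matching.mate M v ≡ nothing)

  InA : Fin n → Set
  InA v = (S v ≡ true) × (¬ InD v) × Σ (Fin n) λ u → Edge v u × InD u

  InC : Fin n → Set
  InC v = (S v ≡ true) × (¬ InD v) × (¬ InA v)

  Bipartite : Set
  Bipartite = Σ (Fin n → Bool) λ col → ∀ u v → Edge u v → col u ≢ col v

  Independent : VSet n → Set
  Independent I = (∀ v → I v ≡ true → S v ≡ true) ×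
                  (∀ u v → I u ≡ true → I v ≡ true → ¬ Edge u v)

  IsMaxIndependent : VSet n → Set
  IsMaxIndependent I = Independent I × (∀ J → Independent J → countB J ≤ countB I)

  -- α(H) + μ(H) = |V(H)|  (multiplied by 2; size2 M = 2 μ(H))
  KonigEgervary : Set
  KonigEgervary = Σ (VSet n) λ I → Σ Matching λ M →
    IsMaxIndependent I × IsMaximum M × (2 * countB I + size2 M ≡ 2 * countB S)

  verts : Cycle → List (Fin n)
  verts c = Cycle.start c ∷ Cycle.rest c

  cedges : Cycle → List (Fin n × Fin n)
  cedges c = pairs (verts c) ++ [ (lastOf (Cycle.start c) (Cycle.rest c) , Cycle.start c) ]

  CycEdge : Cycle → Fin n → Fin n → Set
  CycEdge c u v = ((u , v) ∈ cedges c) ⊎ ((v , u) ∈ cedges c)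

  -- two cycles are the same subgraph iff they have the same edge set
  SameCycle : Cycle → Cycle → Set
  SameCycle c d = ∀ u v → (CycEdge c u v → CycEdge d u v) × (CycEdge d u v → CycEdge c u v)

  OddCycle : Cycle → Set
  OddCycle c = Σ ℕ λ t → length (verts c) ≡ suc (t + t)

  AlmostBipartite : Set
  AlmostBipartite = Σ Cycle λ c → OddCycle c × (∀ d → OddCycle d → SameCycle c d)

  isMEdge : Matching → Fin n → Fin n → Bool
  isMEdge M u v = does (≡-dec _≟F_ (Matching.mate M u) (just v))

  Blossom : Matching → Cycle → Set
  Blossom M c = Σ ℕ λ t → (length (verts c) ≡ suc (t + t)) ×
                (length (filterᵇ (uncurry (isMEdge M)) (cedges c)) ≡ t)

  IsBase : Matching → Cycle → Fin n → Set
  IsBase M c b = (b ∈ verts c) ×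
    (∀ u v → (u , v) ∈ cedges c → isMEdge M u v ≡ true → (u ≢ b) × (v ≢ b))

  Alternating : Matching → List (Fin n) → Set
  Alternating M (x ∷ y ∷ z ∷ r) = (isMEdge M x y ≢ isMEdge M y z) × Alternating M (y ∷ z ∷ r)
  Alternating M _ = ⊤

  record Stem (M : Matching) (c : Cycle) (b : Fin n) : Set where
    field
      path     : List (Fin n)
      distinct : Unique (b ∷ path)
      chain    : Chain (b ∷ path)
      alt      : Alternating M (b ∷ path)
      even     : Σ ℕ λ s → length path ≡ s + s
      endFree  : Matching.mate M (lastOf b path) ≡ nothing
      disjoint : ∀ w → w ∈ path → w ∉ verts c

  record FlowerAt (M : Matching) (C : Cycle) (v : Fin n) : Set where
    field
      blossom   : Cycle
      sameC     : SameCycle blossom C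
      isBlossom : Blossom M blossom
      base      : Fin n
      isBase    : IsBase M blossom base
      stem      : Stem M blossom base
      contains  : (v ∈ verts blossom) ⊎ (v ∈ (base ∷ Stem.path stem))

module _ {n : ℕ} (G : Graph n) where

  data Piece : Set where
    edgeP : (u v : Fin n) → Edge G allV u v → Piece
    cycP  : Cycle G allV → Piece

  pieceVerts : Piece → List (Fin n)
  pieceVerts (edgeP u v _) = u ∷ v ∷ []
  pieceVerts (cycP c)      = verts G allV c

  HasSachs : Set
  HasSachs = Σ (List Piece) λ ps → ∀ v →
    Σ (Fin (length ps)) λ i → (v ∈ pieceVerts (lookup ps i)) ×
      (∀ j → v ∈ pieceVerts (lookup ps j) → j ≡ i)

-- BAB-graph structure: part v = nothing means v ∈ V(B),
-- part v = just i means v ∈ V(G_i).  Since added edges only join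
-- different parts, B = G[part⁻¹ nothing] and G_i = G[part⁻¹ (just i)].
partB : ∀ {n k} → (Fin n → Maybe (Fin k)) → VSet n
partB part v = is-nothing (part v)

partG : ∀ {n k} → (Fin n → Maybe (Fin k)) → Fin k → VSet n
partG part i v = does (≡-dec _≟F_ (part v) (just i))

record IsBAB {n : ℕ} (G : Graph n) (k : ℕ) (part : Fin n → Maybe (Fin k)) : Set where
  field
    bipB     : Bipartite G (partB part)
    almostB  : ∀ i → AlmostBipartite G (partG part i)
    nonKE    : ∀ i → ¬ KonigEgervary G (partG part i)
    flowers  : ∀ i v → partG part i v ≡ true →
               Σ (Matching G (partG part i)) λ M → IsMaximum G (partG part i) M ×
                 FlowerAt G (partG part i) M (Data.Product.proj₁ (almostB i)) v
    crossB   : ∀ u v → adj G u v ≡ true → part u ≢ part v → part u ≡ nothing →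
               InA G (partB part) u ⊎ InC G (partB part) u
    crossG   : ∀ u v → adj G u v ≡ true → part u ≢ part v → ∀ i → part u ≡ just i →
               InA G (partG part i) u

module Submission where

-- If P is a maximum matching of H and N any matching, an N-exposed vertex outside D(H) can be
-- covered by switching N along an alternating path at the cost of one other N-exposed vertex;
-- hence def(H) + |Y| ≤ #(N-exposed vertices) for every set Y of N-exposed vertices outside D(H).
-- The added edges of a BAB-graph only touch vertices outside D of their part, so a maximum matching
-- of G leaves at least def(part) vertices of each part exposed, while gluing maximum matchings of
-- the parts gives a matching of G: def(G) = def(B) + Σ def(Gᵢ).  It remains to see def(Gᵢ) = 1.
-- The stem of a flower ends in an exposed vertex, so def(Gᵢ) ≥ 1.  Pairing consecutive vertices
-- in the pieces of a Sachs subgraph, where an odd cycle drops a vertex outside Gᵢ if it has one,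
-- yields a matching of G exposing, within Gᵢ, only starts of odd cycles lying in Gᵢ; these all
-- meet the unique odd cycle Cᵢ, hence lie in one piece, and restricting gives def(Gᵢ) ≤ 1.

open import Defs
open import Algebra.Properties.CommutativeMonoid.Sum as ∑ using ()
open import Data.Bool using (Bool; true; false; _∧_; not; if_then_else_)
open import Data.Bool.Properties using (∧-zeroʳ; ∧-identityʳ; ¬-not; not-¬) renaming (_≟_ to _≟ᵇ_)
open import Data.Empty using (⊥-elim)
open import Data.Fin using (Fin; zero; suc; _≟_)
open import Data.Fin.Properties using (any?)
open import Data.List using (List; []; _∷_; _++_; length; filterᵇ; tabulate; lookup)
open import Data.List.Properties using (++-identityʳ)
open import Data.List.Membership.Propositional using (_∈_; _∉_; find)
open import Data.List.Membership.Propositional.Properties using (∈-∃++; ∈-++⁻)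
open import Data.List.Relation.Binary.Permutation.Propositional using (_↭_; ↭-sym; ↭-trans; prep; ↭⇒↭ₛ)
open import Data.List.Relation.Binary.Permutation.Propositional.Properties
  using (shift; ++-comm; ∈-resp-↭; ↭-length)
import Data.List.Relation.Binary.Permutation.Setoid.Properties as PermutationSetoid
import Data.List.Relation.Unary.All as All
open import Data.List.Relation.Unary.AllPairs using (_∷_; [])
open import Data.List.Relation.Unary.Any as Any using (here; there)
open import Data.List.Relation.Unary.Unique.Propositional using (Unique)
open import Data.Maybe using (Maybe; just; nothing; is-nothing; is-just; _>>=_)
open import Data.Maybe.Properties using (≡-dec; just-injective)
open import Data.Nat using (ℕ; zero; suc; _+_; _≤_; _<_; z≤n; s≤s)
open import Data.Nat.Induction using (<-wellFounded)
open import Data.Nat.Properties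
  using (+-comm; +-assoc; +-suc; +-identityʳ; +-mono-≤; +-monoˡ-≤; +-cancelˡ-≤; +-cancelʳ-≤;
         +-cancelˡ-≡; +-cancelʳ-≡; +-0-commutativeMonoid; ≤-refl; ≤-trans; ≤-reflexive; ≤-antisym;
         n<1+n; m<m+n; suc-injective; module ≤-Reasoning)
open import Data.Product using (∃; _×_; _,_; proj₁; proj₂)
open import Data.Sum as Sum using (_⊎_; inj₁; inj₂; [_,_]′)
open import Function using (_∘_)
open import Induction.WellFounded using (Acc; acc)
open import Relation.Binary.PropositionalEquality
  using (_≡_; _≢_; _≗_; refl; sym; trans; cong; cong₂; subst; module ≡-Reasoning)
open import Relation.Binary.PropositionalEquality.Properties using (setoid)
open import Relation.Nullary using (¬_; yes; no; does)
open import Relation.Nullary.Decidable using (dec-true; dec-false)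

open ∑ +-0-commutativeMonoid using (sum-syntax; ∑-distrib-+; ∑-comm; sum-cong-≗; sum-replicate-zero)

-- Counting vertices

𝟙 : Bool → ℕ
𝟙 true  = 1
𝟙 false = 0

just≢nothing : ∀ {A : Set} {x : A} → just x ≢ nothing
just≢nothing ()

∧-true⁻ : ∀ {a b} → a ∧ b ≡ true → a ≡ true × b ≡ true
∧-true⁻ {true} b = refl , b

∑-mono-≤ : ∀ {m} {f g : Fin m → ℕ} → (∀ i → f i ≤ g i) → ∑[ i < m ] f i ≤ ∑[ i < m ] g i
∑-mono-≤ {zero}  f≤g = z≤n
∑-mono-≤ {suc m} f≤g = +-mono-≤ (f≤g zero) (∑-mono-≤ (f≤g ∘ suc))

∑-indicator : ∀ {m} (j : Fin m) → ∑[ i < m ] 𝟙 (does (j ≟ i)) ≡ 1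
∑-indicator {suc m} zero    = cong suc (sum-replicate-zero m)
∑-indicator {suc m} (suc j) = ∑-indicator j

∑-ones : ∀ k → ∑[ i < k ] 1 ≡ k
∑-ones zero    = refl
∑-ones (suc k) = cong suc (∑-ones k)

module _ {n : ℕ} where

  infix  4 _⊆_
  infixl 7 _∩_
  infixl 6 _∖_

  _⊆_ : VSet n → VSet n → Set
  f ⊆ g = ∀ v → f v ≡ true → g v ≡ true

  _∩_ _∖_ : VSet n → VSet n → VSet n
  (f ∩ g) v = f v ∧ g v
  (f ∖ g) v = f v ∧ not (g v)

  ⁅_⁆ : Fin n → VSet n
  ⁅ w ⁆ v = does (w ≟ v)

  countB≡∑ : (f : VSet n) → countB f ≡ ∑[ v < n ] 𝟙 (f v)
  countB≡∑ f = length-filter-tabulate (λ v → v)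
    where
    length-filter-tabulate : ∀ {m} (g : Fin m → Fin n) →
      length (filterᵇ f (tabulate g)) ≡ ∑[ i < m ] 𝟙 (f (g i))
    length-filter-tabulate {zero}  g = refl
    length-filter-tabulate {suc m} g with f (g zero)
    ... | true  = cong suc (length-filter-tabulate (g ∘ suc))
    ... | false = length-filter-tabulate (g ∘ suc)

  countB-cong : {f g : VSet n} → f ≗ g → countB f ≡ countB g
  countB-cong {f} {g} f≗g = begin
    countB f            ≡⟨ countB≡∑ f ⟩
    ∑[ v < n ] 𝟙 (f v)  ≡⟨ sum-cong-≗ (cong 𝟙 ∘ f≗g) ⟩
    ∑[ v < n ] 𝟙 (g v)  ≡⟨ countB≡∑ g ⟨
    countB g            ∎
    where open ≡-Reasoning

  countB-mono : {f g : VSet n} → f ⊆ g → countB f ≤ countB g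
  countB-mono {f} {g} f⊆g = begin
    countB f            ≡⟨ countB≡∑ f ⟩
    ∑[ v < n ] 𝟙 (f v)  ≤⟨ ∑-mono-≤ (λ v → 𝟙-mono (f⊆g v)) ⟩
    ∑[ v < n ] 𝟙 (g v)  ≡⟨ countB≡∑ g ⟨
    countB g            ∎
    where
    open ≤-Reasoning
    𝟙-mono : ∀ {a b} → (a ≡ true → b ≡ true) → 𝟙 a ≤ 𝟙 b
    𝟙-mono {false}     _   = z≤n
    𝟙-mono {true}  {b} a⇒b rewrite a⇒b refl = ≤-refl

  countB-split : (f g : VSet n) → countB f ≡ countB (f ∩ g) + countB (f ∖ g)
  countB-split f g = begin
    countB f
      ≡⟨ countB≡∑ f ⟩
    ∑[ v < n ] 𝟙 (f v)
      ≡⟨ sum-cong-≗ (λ v → 𝟙-split (f v) (g v)) ⟩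
    ∑[ v < n ] (𝟙 ((f ∩ g) v) + 𝟙 ((f ∖ g) v))
      ≡⟨ ∑-distrib-+ (𝟙 ∘ (f ∩ g)) (𝟙 ∘ (f ∖ g)) ⟩
    ∑[ v < n ] 𝟙 ((f ∩ g) v) + ∑[ v < n ] 𝟙 ((f ∖ g) v)
      ≡⟨ cong₂ _+_ (countB≡∑ (f ∩ g)) (countB≡∑ (f ∖ g)) ⟨
    countB (f ∩ g) + countB (f ∖ g)
      ∎
    where
    open ≡-Reasoning
    𝟙-split : ∀ a b → 𝟙 a ≡ 𝟙 (a ∧ b) + 𝟙 (a ∧ not b)
    𝟙-split false b     = refl
    𝟙-split true  false = refl
    𝟙-split true  true  = refl

  countB-difference : {f g : VSet n} → g ⊆ f → countB f ≡ countB g + countB (f ∖ g)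
  countB-difference {f} {g} g⊆f = trans (countB-split f g) (cong (_+ countB (f ∖ g)) (countB-cong f∩g≗g))
    where
    f∩g≗g : f ∩ g ≗ g
    f∩g≗g v with g v in gv
    ... | true  = trans (∧-identityʳ (f v)) (g⊆f v gv)
    ... | false = ∧-zeroʳ (f v)

  countB-empty : {f : VSet n} → (∀ v → f v ≢ true) → countB f ≡ 0
  countB-empty {f} empty = begin
    countB f                  ≡⟨ countB-cong (λ v → ¬-not (empty v)) ⟩
    countB {n} (λ _ → false)  ≡⟨ countB≡∑ (λ _ → false) ⟩
    ∑[ v < n ] 0              ≡⟨ sum-replicate-zero n ⟩
    0                         ∎
    where open ≡-Reasoning

  countB-⁅⁆ : (w : Fin n) → countB ⁅ w ⁆ ≡ 1
  countB-⁅⁆ w = trans (countB≡∑ ⁅ w ⁆) (∑-indicator w)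

  countB-remove : (f : VSet n) {w : Fin n} → f w ≡ true → countB f ≡ suc (countB (f ∖ ⁅ w ⁆))
  countB-remove f {w} fw = trans (countB-difference ⁅w⁆⊆f) (cong (_+ countB (f ∖ ⁅ w ⁆)) (countB-⁅⁆ w))
    where
    ⁅w⁆⊆f : ⁅ w ⁆ ⊆ f
    ⁅w⁆⊆f v w≡v with w ≟ v
    ... | yes refl = fw

  countB-< : {f g : VSet n} (w : Fin n) → g ⊆ f →
    f w ≡ true → g w ≡ false → countB g < countB f
  countB-< {f} {g} w g⊆f fw gw = begin-strict
    countB g                    ≤⟨ countB-mono g⊆f∖w ⟩
    countB (f ∖ ⁅ w ⁆)          <⟨ n<1+n _ ⟩
    suc (countB (f ∖ ⁅ w ⁆))    ≡⟨ countB-remove f fw ⟨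
    countB f                    ∎
    where
    open ≤-Reasoning
    g⊆f∖w : g ⊆ f ∖ ⁅ w ⁆
    g⊆f∖w v gv with w ≟ v
    ... | yes refl with () ← trans (sym gv) gw
    ... | no  _    rewrite g⊆f v gv = refl

  countB-pos : {f : VSet n} (w : Fin n) → f w ≡ true → 1 ≤ countB f
  countB-pos {f} w fw = subst (1 ≤_) (sym (countB-remove f fw)) (s≤s z≤n)

  countB-subsingleton : {f : VSet n} → (∀ u v → f u ≡ true → f v ≡ true → u ≡ v) → countB f ≤ 1
  countB-subsingleton {f} unique with any? (λ w → f w ≟ᵇ true)
  ... | yes (w , fw) =
    subst (countB f ≤_) (countB-⁅⁆ w) (countB-mono (λ v fv → dec-true (w ≟ v) (unique w v fw fv)))
  ... | no  none     = subst (_≤ 1) (sym (countB-empty (λ v fv → none (v , fv)))) z≤n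

-- Matchings

module _ {n : ℕ} {G : Graph n} {S : VSet n} where

  open Matching

  edge-sym : {u v : Fin n} → Edge G S u v → Edge G S v u
  edge-sym {u} {v} (Su , Sv , uv) = Sv , Su , trans (adj-sym G v u) uv

  edge-≢ : {u v : Fin n} → Edge G S u v → u ≢ v
  edge-≢ {u} (_ , _ , uu) refl with () ← trans (sym uu) (adj-irr G u)

  mate-edge : (M : Matching G S) {u w : Fin n} → mate M u ≡ just w → Edge G S u w
  mate-edge M {u} {w} uw = proj₁ (valid M u w uw)

  mate-sym : (M : Matching G S) {u w : Fin n} → mate M u ≡ just w → mate M w ≡ just u
  mate-sym M {u} {w} uw = proj₂ (valid M u w uw)

  exposed : Matching G S → VSet n
  exposed M v = S v ∧ is-nothing (mate M v)

  exposed⁻ : (M : Matching G S) {v : Fin n} → exposed M v ≡ true → S v ≡ true × mate M v ≡ nothing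
  exposed⁻ M {v} Ev with mate M v | ∧-true⁻ {S v} Ev
  ... | nothing | Sv , _ = Sv , refl

  exposed⁺ : (M : Matching G S) {v : Fin n} → S v ≡ true → mate M v ≡ nothing → exposed M v ≡ true
  exposed⁺ M Sv Mv rewrite Sv | Mv = refl

  size2+uncovered : (M : Matching G S) → size2 G S M + uncovered G S M ≡ countB S
  size2+uncovered M = sym (trans (countB-split S (is-just ∘ mate M))
                                 (cong (_+ uncovered G S M) (countB-cong covered⊆S)))
    where
    covered⊆S : S ∩ (is-just ∘ mate M) ≗ is-just ∘ mate M
    covered⊆S v with mate M v in Mv
    ... | just _  = trans (cong (_∧ true) (proj₁ (mate-edge M Mv))) refl
    ... | nothing = ∧-zeroʳ (S v)

  IsMaximum⇒uncovered-≤ : {P : Matching G S} → IsMaximum G S P →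
    (N : Matching G S) → uncovered G S P ≤ uncovered G S N
  IsMaximum⇒uncovered-≤ {P} P-max N = +-cancelˡ-≤ (size2 G S N) _ _ (begin
    size2 G S N + uncovered G S P  ≤⟨ +-monoˡ-≤ _ (P-max N) ⟩
    size2 G S P + uncovered G S P  ≡⟨ size2+uncovered P ⟩
    countB S                       ≡⟨ size2+uncovered N ⟨
    size2 G S N + uncovered G S N  ∎)
    where open ≤-Reasoning

  IsMaximum-resp-uncovered : {P Q : Matching G S} → IsMaximum G S P →
    uncovered G S Q ≡ uncovered G S P → IsMaximum G S Q
  IsMaximum-resp-uncovered {P} {Q} P-max Q≡P N = begin
    size2 G S N  ≤⟨ P-max N ⟩
    size2 G S P  ≡⟨ +-cancelʳ-≡ (uncovered G S P) _ _ (begin-equality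
      size2 G S P + uncovered G S P  ≡⟨ size2+uncovered P ⟩
      countB S                       ≡⟨ size2+uncovered Q ⟨
      size2 G S Q + uncovered G S Q  ≡⟨ cong (size2 G S Q +_) Q≡P ⟩
      size2 G S Q + uncovered G S P  ∎) ⟩
    size2 G S Q  ∎
    where open ≤-Reasoning

  -- Match b with the exposed vertex c, leaving the old partner of b (if any) exposed: this
  -- augments M when b is exposed and otherwise shifts an edge without changing the size.
  module _ (M : Matching G S) {b c : Fin n} (bc : Edge G S b c) (c-free : mate M c ≡ nothing) where

    rematchMate : Fin n → Maybe (Fin n)
    rematchMate v =
      if does (b ≟ v) then just c
      else if does (c ≟ v) then just b
      else if isMEdge G S M v b then nothing
      else mate M v

    private
      b≢c : b ≢ c
      b≢c = edge-≢ bc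

      c≢matched : ∀ {u w} → mate M u ≡ just w → c ≢ u
      c≢matched uw refl with () ← trans (sym c-free) uw

    rematch-b : rematchMate b ≡ just c
    rematch-b rewrite dec-true (b ≟ b) refl = refl

    rematch-c : rematchMate c ≡ just b
    rematch-c rewrite dec-false (b ≟ c) b≢c | dec-true (c ≟ c) refl = refl

    rematch-partner : ∀ {a} → mate M a ≡ just b → rematchMate a ≡ nothing
    rematch-partner {a} ab
      rewrite dec-false (b ≟ a) (λ b≡a → edge-≢ (mate-edge M ab) (sym b≡a))
            | dec-false (c ≟ a) (c≢matched ab)
            | dec-true (≡-dec _≟_ (mate M a) (just b)) ab = refl

    rematch-unchanged : ∀ {v} → b ≢ v → c ≢ v → mate M v ≢ just b → rematchMate v ≡ mate M v
    rematch-unchanged {v} b≢v c≢v v↛b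
      rewrite dec-false (b ≟ v) b≢v | dec-false (c ≟ v) c≢v
            | dec-false (≡-dec _≟_ (mate M v) (just b)) v↛b = refl

    private
      rematch-valid : ∀ u w → rematchMate u ≡ just w → Edge G S u w × (rematchMate w ≡ just u)
      rematch-valid u w uw with b ≟ u
      rematch-valid _ _ refl | yes refl = bc , rematch-c
      ... | no b≢u with c ≟ u
      rematch-valid _ _ refl | no b≢u | yes refl = edge-sym bc , rematch-b
      ... | no c≢u with ≡-dec _≟_ (mate M u) (just b)
      ... | no u↛b =
        mate-edge M uw , trans (rematch-unchanged b≢w (c≢matched (mate-sym M uw)) w↛b) (mate-sym M uw)
        where
        b≢w : b ≢ w
        b≢w refl = u↛b uw
        w↛b : mate M w ≢ just b
        w↛b wb = b≢u (just-injective (trans (sym wb) (mate-sym M uw)))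

    rematch : Matching G S
    rematch = record { mate = rematchMate ; valid = rematch-valid }

    rematch-exposed : ∀ {v} → rematchMate v ≡ nothing → mate M v ≡ nothing ⊎ mate M v ≡ just b
    rematch-exposed {v} v-free with b ≟ v
    ... | no b≢v with c ≟ v
    ... | no c≢v with ≡-dec _≟_ (mate M v) (just b)
    ... | yes vb = inj₂ vb
    ... | no  _  = inj₁ v-free

    rematch-uncovered-augment : mate M b ≡ nothing → uncovered G S rematch + 2 ≡ uncovered G S M
    rematch-uncovered-augment b-free = begin
      countB E′ + 2                              ≡⟨ +-comm (countB E′) 2 ⟩
      2 + countB E′                              ≡⟨ cong (2 +_) (countB-cong E′≗E∖b∖c) ⟩
      2 + countB (E ∖ ⁅ b ⁆ ∖ ⁅ c ⁆)             ≡⟨ cong suc (countB-remove (E ∖ ⁅ b ⁆) E∖b-c) ⟨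
      suc (countB (E ∖ ⁅ b ⁆))                   ≡⟨ countB-remove E E-b ⟨
      countB E                                   ∎
      where
      open ≡-Reasoning
      E E′ : VSet n
      E = exposed M
      E′ = exposed rematch
      E-b : E b ≡ true
      E-b = exposed⁺ M (proj₁ bc) b-free
      E∖b-c : (E ∖ ⁅ b ⁆) c ≡ true
      E∖b-c rewrite proj₁ (proj₂ bc) | c-free | dec-false (b ≟ c) b≢c = refl
      E′≗E∖b∖c : E′ ≗ E ∖ ⁅ b ⁆ ∖ ⁅ c ⁆
      E′≗E∖b∖c v with b ≟ v
      ... | yes refl = trans (∧-zeroʳ (S b)) (sym (cong (_∧ not (does (c ≟ b))) (∧-zeroʳ (E b))))
      ... | no _ with c ≟ v
      ... | yes refl = trans (∧-zeroʳ (S c)) (sym (∧-zeroʳ (E c ∧ true)))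
      ... | no _ with ≡-dec _≟_ (mate M v) (just b)
      ... | yes vb with () ← trans (sym (mate-sym M vb)) b-free
      ... | no  _  = sym (trans (∧-identityʳ (E v ∧ true)) (∧-identityʳ (E v)))

    rematch-uncovered-shift : ∀ {a} → mate M b ≡ just a → uncovered G S rematch ≡ uncovered G S M
    rematch-uncovered-shift {a} ba = begin
      countB E′                   ≡⟨ countB-remove E′ E′-a ⟩
      suc (countB (E′ ∖ ⁅ a ⁆))   ≡⟨ cong suc (countB-cong E′∖a≗E∖c) ⟩
      suc (countB (E ∖ ⁅ c ⁆))    ≡⟨ countB-remove E E-c ⟨
      countB E                    ∎
      where
      open ≡-Reasoning
      E E′ : VSet n
      E = exposed M
      E′ = exposed rematch
      ab : mate M a ≡ just b
      ab = mate-sym M ba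
      E′-a : E′ a ≡ true
      E′-a = exposed⁺ rematch (proj₁ (mate-edge M ab)) (rematch-partner ab)
      E-c : E c ≡ true
      E-c = exposed⁺ M (proj₁ (proj₂ bc)) c-free
      E′∖a≗E∖c : E′ ∖ ⁅ a ⁆ ≗ E ∖ ⁅ c ⁆
      E′∖a≗E∖c v with b ≟ v
      ... | yes refl rewrite ba = trans (cong (_∧ not (does (a ≟ b))) (∧-zeroʳ (S b)))
                                        (sym (cong (_∧ not (does (c ≟ b))) (∧-zeroʳ (S b))))
      ... | no _ with c ≟ v
      ... | yes refl = trans (cong (_∧ not (does (a ≟ c))) (∧-zeroʳ (S c))) (sym (∧-zeroʳ (E c)))
      ... | no _ with ≡-dec _≟_ (mate M v) (just b)
      ... | yes vb rewrite just-injective (trans (sym ba) (mate-sym M vb)) | vb | dec-true (v ≟ v) refl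
        = trans (∧-zeroʳ (S v ∧ true)) (sym (trans (∧-identityʳ (S v ∧ false)) (∧-zeroʳ (S v))))
      ... | no v↛b with a ≟ v
      ... | yes refl = ⊥-elim (v↛b ab)
      ... | no _ = refl

  -- Augmenting paths

  record Augmentation (N : Matching G S) (y : Fin n) : Set where
    field
      matching        : Matching G S
      uncovered-drops : uncovered G S matching + 2 ≡ uncovered G S N
      exposed⊆        : ∀ {v} → mate matching v ≡ nothing → mate N v ≡ nothing
      covers          : mate matching y ≢ nothing

  record ExposingVariant (N P : Matching G S) (y : Fin n) : Set where
    field
      matching  : Matching G S
      same-size : uncovered G S matching ≡ uncovered G S P
      exposes   : mate matching y ≡ nothing
      keeps     : ∀ {v} → mate N v ≡ mate P v → mate matching v ≡ mate P v

  module _ (P : Matching G S) where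

    disagree : Matching G S → VSet n
    disagree N v = not (does (≡-dec _≟_ (mate N v) (mate P v)))

    disagree⁺ : (M : Matching G S) {v : Fin n} → mate M v ≢ mate P v → disagree M v ≡ true
    disagree⁺ M M≠P = cong not (dec-false (≡-dec _≟_ _ _) M≠P)

    disagree⁻ : (M : Matching G S) {v : Fin n} → disagree M v ≡ true → mate M v ≢ mate P v
    disagree⁻ M {v} M≠P MP with ≡-dec _≟_ (mate M v) (mate P v)
    ... | no M≢P = M≢P MP

    module AlternatingStep (N : Matching G S) {y p q : Fin n} (Ny : mate N y ≡ nothing)
                (Py : mate P y ≡ just p) (Np : mate N p ≡ just q) where

      yp : Edge G S p y
      yp = edge-sym (mate-edge P Py)

      N₁ : Matching G S
      N₁ = rematch N yp Ny

      N₁-q : mate N₁ q ≡ nothing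
      N₁-q = rematch-partner N yp Ny (mate-sym N Np)

      Pp : mate P p ≡ just y
      Pp = mate-sym P Py

      q≢y : q ≢ y
      q≢y refl = just≢nothing (trans (sym (mate-sym N Np)) Ny)

      Pq↛p : mate P q ≢ just p
      Pq↛p qp = q≢y (just-injective (trans (sym (mate-sym P qp)) Pp))

      record OffPath (v : Fin n) : Set where
        field
          y≢v : y ≢ v
          p≢v : p ≢ v
          q≢v : q ≢ v
          Pv↛p : mate P v ≢ just p
          Nv↛p : mate N v ≢ just p

      agreement⇒offPath : ∀ {v} → mate N v ≡ mate P v → OffPath v
      agreement⇒offPath {v} NP = record
        { y≢v  = y≢v
        ; p≢v  = λ { refl → q≢y (just-injective (trans (sym Np) (trans NP Pp))) }
        ; q≢v  = q≢v
        ; Pv↛p = λ vp → y≢v (just-injective (trans (sym Pp) (mate-sym P vp)))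
        ; Nv↛p = λ vp → q≢v (just-injective (trans (sym Np) (mate-sym N vp)))
        }
        where
        y≢v : y ≢ v
        y≢v refl = just≢nothing (trans (sym Py) (trans (sym NP) Ny))
        q≢v : q ≢ v
        q≢v refl = Pq↛p (trans (sym NP) (mate-sym N Np))

      N₁-keeps-agreement : ∀ {v} → mate N v ≡ mate P v → mate N₁ v ≡ mate P v
      N₁-keeps-agreement NP = trans (rematch-unchanged N yp Ny p≢v y≢v Nv↛p) NP
        where open OffPath (agreement⇒offPath NP)

      fewer-disagreements : countB (disagree N₁) < countB (disagree N)
      fewer-disagreements = countB-< y
        (λ v N₁≠P → disagree⁺ N (disagree⁻ N₁ N₁≠P ∘ N₁-keeps-agreement))
        (disagree⁺ N λ NP → just≢nothing (trans (sym Py) (trans (sym NP) Ny)))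
        (cong not (dec-true (≡-dec _≟_ _ _) (trans (rematch-c N yp Ny) (sym Py))))

      exposing-by-shift : mate P q ≡ nothing → ExposingVariant N P y
      exposing-by-shift Pq = record
        { matching  = rematch P pq Pq
        ; same-size = rematch-uncovered-shift P pq Pq Pp
        ; exposes   = rematch-partner P pq Pq Py
        ; keeps     = λ NP → let open OffPath (agreement⇒offPath NP) in
                      rematch-unchanged P pq Pq p≢v q≢v Pv↛p
        }
        where pq : Edge G S p q
              pq = mate-edge N Np

      lift-augmentation : Augmentation N₁ q → Augmentation N y
      lift-augmentation A = record
        { matching        = matching
        ; uncovered-drops = trans uncovered-drops (rematch-uncovered-shift N yp Ny Np)
        ; exposed⊆        = λ {v} free → [ (λ v-free → v-free)
                                         , (λ vp → ⊥-elim (covers (subst (λ u → mate matching u ≡ nothing)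
                                                      (just-injective (trans (sym (mate-sym N vp)) Np)) free))) ]′
                                         (rematch-exposed N yp Ny (exposed⊆ free))
        ; covers          = λ free → just≢nothing (trans (sym (rematch-c N yp Ny)) (exposed⊆ free))
        }
        where open Augmentation A

      lift-exposing : ExposingVariant N₁ P q → ExposingVariant N P y
      lift-exposing E = record
        { matching  = rematch matching pq exposes
        ; same-size = trans (rematch-uncovered-shift matching pq exposes (mate-sym matching P′y)) same-size
        ; exposes   = rematch-partner matching pq exposes P′y
        ; keeps     = λ NP →
            let open OffPath (agreement⇒offPath NP) ; P′≡P = keeps (N₁-keeps-agreement NP) in
            trans (rematch-unchanged matching pq exposes p≢v q≢v (Pv↛p ∘ trans (sym P′≡P))) P′≡P
        }
        where
        open ExposingVariant E
        pq : Edge G S p q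
        pq = mate-edge N Np
        P′y : mate matching y ≡ just p
        P′y = trans (keeps (trans (rematch-c N yp Ny) (sym Py))) Py

    -- Walk along the alternating path y, p = P y, q = N p, …: if p is N-exposed, yp augments N;
    -- if q is P-exposed, moving P's edge at p to pq exposes y; otherwise N is shifted to match p
    -- with y, so that N₁ agrees with P at y (which bounds the recursion), and the walk continues
    -- from q.  A variant of P exposing q keeps the edge yp of P, since N₁ agrees with P at y, so
    -- it can be shifted back along pq to expose y.
    alternating-path : (N : Matching G S) (y : Fin n) → mate N y ≡ nothing →
      Acc _<_ (countB (disagree N)) → Augmentation N y ⊎ ExposingVariant N P y
    alternating-path N y Ny (acc smaller) with mate P y in Py
    ... | nothing = inj₂ record { matching = P ; same-size = refl ; exposes = Py ; keeps = λ _ → refl }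
    ... | just p with mate N p in Np
    ... | nothing = inj₁ record
      { matching        = rematch N yp Ny
      ; uncovered-drops = rematch-uncovered-augment N yp Ny Np
      ; exposed⊆        = λ free → [ (λ v-free → v-free)
                                   , (λ vp → ⊥-elim (just≢nothing (trans (sym (mate-sym N vp)) Np))) ]′
                                   (rematch-exposed N yp Ny free)
      ; covers          = λ free → just≢nothing (trans (sym (rematch-c N yp Ny)) free)
      }
      where yp : Edge G S p y
            yp = edge-sym (mate-edge P Py)
    ... | just q with mate P q in Pq
    ... | nothing = inj₂ (exposing-by-shift Pq)
      where open AlternatingStep N Ny Py Np
    ... | just _  = Sum.map lift-augmentation lift-exposing
                      (alternating-path N₁ q N₁-q (smaller fewer-disagreements))
      where open AlternatingStep N Ny Py Np

  augment : {P : Matching G S} → IsMaximum G S P → (N : Matching G S) {y : Fin n} →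
    S y ≡ true → mate N y ≡ nothing → ¬ InD G S y → Augmentation N y
  augment {P} P-max N {y} Sy Ny y∉D with alternating-path P N y Ny (<-wellFounded (countB (disagree P N)))
  ... | inj₁ A = A
  ... | inj₂ E = ⊥-elim (y∉D (Sy , matching , IsMaximum-resp-uncovered {P} {matching} P-max same-size , exposes))
    where open ExposingVariant E

  uncovered+exposedOutsideD≤ : {P : Matching G S} → IsMaximum G S P → (N : Matching G S) (Y : VSet n) →
    Y ⊆ exposed N → (∀ v → Y v ≡ true → ¬ InD G S v) → uncovered G S P + countB Y ≤ uncovered G S N
  uncovered+exposedOutsideD≤ {P} P-max N Y Y⊆E Y∉D = go N Y Y⊆E Y∉D (<-wellFounded (uncovered G S N))
    where
    go : (N : Matching G S) (Y : VSet n) → Y ⊆ exposed N → (∀ v → Y v ≡ true → ¬ InD G S v) →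
      Acc _<_ (uncovered G S N) → uncovered G S P + countB Y ≤ uncovered G S N
    go N Y Y⊆E Y∉D (acc smaller) with any? (λ v → Y v ≟ᵇ true)
    ... | no none = begin
      uncovered G S P + countB Y  ≡⟨ cong (uncovered G S P +_) (countB-empty (λ v Yv → none (v , Yv))) ⟩
      uncovered G S P + 0         ≡⟨ +-identityʳ (uncovered G S P) ⟩
      uncovered G S P             ≤⟨ IsMaximum⇒uncovered-≤ {P} P-max N ⟩
      uncovered G S N             ∎
      where open ≤-Reasoning
    ... | yes (y , Yy) = begin
      uncovered G S P + countB Y                              ≡⟨ cong (uncovered G S P +_) (countB-split Y E′) ⟩
      uncovered G S P + (countB (Y ∩ E′) + countB (Y ∖ E′))   ≡⟨ +-assoc (uncovered G S P) _ _ ⟨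
      uncovered G S P + countB (Y ∩ E′) + countB (Y ∖ E′)     ≤⟨ +-mono-≤ still-exposed Y∖E′≤2 ⟩
      uncovered G S N′ + 2                                    ≡⟨ uncovered-drops ⟩
      uncovered G S N                                         ∎
      where
      open ≤-Reasoning
      A : Augmentation N y
      A = augment {P} P-max N (proj₁ (exposed⁻ N (Y⊆E y Yy))) (proj₂ (exposed⁻ N (Y⊆E y Yy))) (Y∉D y Yy)
      open Augmentation A renaming (matching to N′)
      E E′ : VSet n
      E = exposed N
      E′ = exposed N′
      still-exposed : uncovered G S P + countB (Y ∩ E′) ≤ uncovered G S N′
      still-exposed = go N′ (Y ∩ E′) (λ v → proj₂ ∘ ∧-true⁻ {Y v})
                         (λ v → Y∉D v ∘ proj₁ ∘ ∧-true⁻ {Y v})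
                         (smaller (≤-trans (m<m+n _ (s≤s z≤n)) (≤-reflexive uncovered-drops)))
      E′⊆E : E′ ⊆ E
      E′⊆E v E′v = let (Sv , N′v) = exposed⁻ N′ E′v in exposed⁺ N Sv (exposed⊆ N′v)
      Y∖E′≤2 : countB (Y ∖ E′) ≤ 2
      Y∖E′≤2 = begin
        countB (Y ∖ E′)  ≤⟨ countB-mono (λ v Y∖E′v → let (Yv , ¬E′v) = ∧-true⁻ {Y v} Y∖E′v in
                                          subst (λ b → b ∧ not (E′ v) ≡ true) (sym (Y⊆E v Yv)) ¬E′v) ⟩
        countB (E ∖ E′)  ≡⟨ +-cancelˡ-≡ (countB E′) _ _
                               (trans (sym (countB-difference E′⊆E)) (sym uncovered-drops)) ⟩
        2                ∎

-- Restricting and gluing matchings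

BoundaryAvoidsD : ∀ {n} (G : Graph n) (S : VSet n) → Set
BoundaryAvoidsD G S = ∀ {v w} → S v ≡ true → adj G v w ≡ true → S w ≡ false → ¬ InD G S v

module _ {n : ℕ} {G : Graph n} where

  open Matching

  private
    restrictMate : Matching G allV → VSet n → Fin n → Maybe (Fin n)
    restrictMate M S v = if S v then (mate M v >>= λ w → if S w then just w else nothing) else nothing

  restrict : Matching G allV → (S : VSet n) → Matching G S
  restrict M S = record { mate = restrictMate M S ; valid = restrict-valid }
    where
    restrict-valid : ∀ u w → restrictMate M S u ≡ just w → Edge G S u w × (restrictMate M S w ≡ just u)
    restrict-valid u w uw with S u in Su | mate M u in Mu
    ... | true | just w′ with S w′ in Sw′
    restrict-valid u w refl | true | just w′ | true = (refl , Sw′ , proj₂ (proj₂ (mate-edge M Mu))) , back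
      where
      back : restrictMate M S w′ ≡ just u
      back rewrite Sw′ | mate-sym M Mu | Su = refl

  -- Besides the M-exposed vertices of S, the restriction of M to S exposes only vertices that M
  -- matches out of S, and these lie outside D(S) by hypothesis.
  uncovered≤exposed∩ : (M : Matching G allV) {S : VSet n} → BoundaryAvoidsD G S →
    {P : Matching G S} → IsMaximum G S P → uncovered G S P ≤ countB (exposed M ∩ S)
  uncovered≤exposed∩ M {S} boundary∉D {P} P-max = +-cancelʳ-≤ (countB Y) _ _ (begin
    uncovered G S P + countB Y
      ≤⟨ uncovered+exposedOutsideD≤ {P = P} P-max N Y (λ v → proj₁ ∘ ∧-true⁻) Y∉D ⟩
    uncovered G S N
      ≡⟨ countB-split (exposed N) (is-just ∘ mate M) ⟩
    countB Y + countB (exposed N ∖ (is-just ∘ mate M))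
      ≡⟨ cong (countB Y +_) (countB-cong restricted-exposed) ⟩
    countB Y + countB (exposed M ∩ S)
      ≡⟨ +-comm (countB Y) _ ⟩
    countB (exposed M ∩ S) + countB Y
      ∎)
    where
    open ≤-Reasoning
    N : Matching G S
    N = restrict M S
    Y : VSet n
    Y = exposed N ∩ (is-just ∘ mate M)
    Y-leaves : ∀ v → Y v ≡ true → S v ≡ true × ∃ λ w → mate M v ≡ just w × S w ≡ false
    Y-leaves v Yv with S v in Sv | mate M v in Mv
    ... | true | just w with S w in Sw
    ... | false = refl , w , refl , Sw
    Y∉D : ∀ v → Y v ≡ true → ¬ InD G S v
    Y∉D v Yv = let (Sv , w , Mv , Sw) = Y-leaves v Yv in boundary∉D Sv (proj₂ (proj₂ (mate-edge M Mv))) Sw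
    restricted-exposed : exposed N ∖ (is-just ∘ mate M) ≗ exposed M ∩ S
    restricted-exposed v with S v | mate M v
    ... | true  | nothing = refl
    ... | false | nothing = refl
    ... | true  | just _  = ∧-zeroʳ _
    ... | false | just _  = refl

module _ {n k : ℕ} (part : Fin n → Maybe (Fin k)) where

  partOf : Maybe (Fin k) → VSet n
  partOf nothing  = partB part
  partOf (just i) = partG part i

  partOf-sound : ∀ j {v} → partOf j v ≡ true → part v ≡ j
  partOf-sound nothing  {v} Bv with part v
  ... | nothing = refl
  partOf-sound (just i) {v} Gv with ≡-dec _≟_ (part v) (just i)
  ... | yes vi = vi

  partOf-own : ∀ v → partOf (part v) v ≡ true
  partOf-own v with part v in pv
  ... | nothing rewrite pv = refl
  ... | just i  = dec-true (≡-dec _≟_ (part v) (just i)) pv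

  countB-parts : (f : VSet n) → countB f ≡ countB (f ∩ partB part) + ∑[ i < k ] countB (f ∩ partG part i)
  countB-parts f = begin
    countB f
      ≡⟨ countB≡∑ f ⟩
    ∑[ v < n ] 𝟙 (f v)
      ≡⟨ sum-cong-≗ (λ v → 𝟙-parts (f v) (part v)) ⟩
    ∑[ v < n ] (𝟙 ((f ∩ partB part) v) + ∑[ i < k ] 𝟙 ((f ∩ partG part i) v))
      ≡⟨ ∑-distrib-+ (𝟙 ∘ (f ∩ partB part)) (λ v → ∑[ i < k ] 𝟙 ((f ∩ partG part i) v)) ⟩
    ∑[ v < n ] 𝟙 ((f ∩ partB part) v) + ∑[ v < n ] ∑[ i < k ] 𝟙 ((f ∩ partG part i) v)
      ≡⟨ cong₂ _+_ (sym (countB≡∑ (f ∩ partB part)))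
                   (∑-comm (λ v i → 𝟙 ((f ∩ partG part i) v))) ⟩
    countB (f ∩ partB part) + ∑[ i < k ] ∑[ v < n ] 𝟙 ((f ∩ partG part i) v)
      ≡⟨ cong (countB (f ∩ partB part) +_) (sum-cong-≗ (λ i → sym (countB≡∑ (f ∩ partG part i)))) ⟩
    countB (f ∩ partB part) + ∑[ i < k ] countB (f ∩ partG part i)
      ∎
    where
    open ≡-Reasoning
    𝟙-parts : ∀ b x →
      𝟙 b ≡ 𝟙 (b ∧ is-nothing x) + ∑[ i < k ] 𝟙 (b ∧ does (≡-dec _≟_ x (just i)))
    𝟙-parts false x        = sym (sum-replicate-zero k)
    𝟙-parts true  nothing  = sym (cong suc (sum-replicate-zero k))
    𝟙-parts true  (just j) = sym (∑-indicator j)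

  module _ {G : Graph n} where

    open Matching

    glue : ((j : Maybe (Fin k)) → Matching G (partOf j)) → Matching G allV
    glue Ms = record { mate = λ v → mate (Ms (part v)) v ; valid = glue-valid }
      where
      glue-valid : ∀ u w → mate (Ms (part u)) u ≡ just w → Edge G allV u w × (mate (Ms (part w)) w ≡ just u)
      glue-valid u w uw = (refl , refl , proj₂ (proj₂ (mate-edge (Ms (part u)) uw))) , back
        where
        same-part : part w ≡ part u
        same-part = partOf-sound (part u) (proj₁ (proj₂ (mate-edge (Ms (part u)) uw)))
        back : mate (Ms (part w)) w ≡ just u
        back = subst (λ j → mate (Ms j) w ≡ just u) (sym same-part) (mate-sym (Ms (part u)) uw)

    exposed-glue : (Ms : (j : Maybe (Fin k)) → Matching G (partOf j)) (j : Maybe (Fin k)) →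
      exposed (glue Ms) ∩ partOf j ≗ exposed (Ms j)
    exposed-glue Ms j v with partOf j v in jv
    ... | true  rewrite partOf-sound j jv = ∧-identityʳ _
    ... | false = ∧-zeroʳ _

    Separated : Set
    Separated = ∀ u v → adj G u v ≡ true → part u ≢ part v → ¬ InD G (partOf (part u)) u

    separated⇒boundaryAvoidsD : Separated → ∀ j → BoundaryAvoidsD G (partOf j)
    separated⇒boundaryAvoidsD separated j {v} {w} jv vw jw =
      subst (λ j′ → ¬ InD G (partOf j′) v) v∈j (separated v w vw v≁w)
      where
      v∈j : part v ≡ j
      v∈j = partOf-sound j jv
      v≁w : part v ≢ part w
      v≁w same with () ← trans (sym (partOf-own w))
                               (subst (λ j′ → partOf j′ w ≡ false) (trans (sym v∈j) same) jw)

    ∑uncovered : ((j : Maybe (Fin k)) → Matching G (partOf j)) → ℕ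
    ∑uncovered Ms = uncovered G (partB part) (Ms nothing) + ∑[ i < k ] uncovered G (partG part i) (Ms (just i))

    uncovered-additive : Separated → (M : Matching G allV) → IsMaximum G allV M →
      (Ms : (j : Maybe (Fin k)) → Matching G (partOf j)) → (∀ j → IsMaximum G (partOf j) (Ms j)) →
      uncovered G allV M ≡ ∑uncovered Ms
    uncovered-additive separated M M-max Ms Ms-max = ≤-antisym upper lower
      where
      open ≤-Reasoning
      upper : uncovered G allV M ≤ ∑uncovered Ms
      upper = begin
        uncovered G allV M
          ≤⟨ IsMaximum⇒uncovered-≤ {P = M} M-max (glue Ms) ⟩
        uncovered G allV (glue Ms)
          ≡⟨ countB-parts (exposed (glue Ms)) ⟩
        countB (exposed (glue Ms) ∩ partB part) + ∑[ i < k ] countB (exposed (glue Ms) ∩ partG part i)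
          ≡⟨ cong₂ _+_ (countB-cong (exposed-glue Ms nothing))
                       (sum-cong-≗ (countB-cong ∘ exposed-glue Ms ∘ just)) ⟩
        uncovered G (partB part) (Ms nothing) + ∑[ i < k ] uncovered G (partG part i) (Ms (just i))
          ∎
      lower : ∑uncovered Ms ≤ uncovered G allV M
      lower = begin
        uncovered G (partB part) (Ms nothing) + ∑[ i < k ] uncovered G (partG part i) (Ms (just i))
          ≤⟨ +-mono-≤ (restriction-bound nothing) (∑-mono-≤ (restriction-bound ∘ just)) ⟩
        countB (exposed M ∩ partB part) + ∑[ i < k ] countB (exposed M ∩ partG part i)
          ≡⟨ countB-parts (exposed M) ⟨
        uncovered G allV M
          ∎
        where
        restriction-bound : ∀ j → uncovered G (partOf j) (Ms j) ≤ countB (exposed M ∩ partOf j)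
        restriction-bound j = uncovered≤exposed∩ M (separated⇒boundaryAvoidsD separated j) {Ms j} (Ms-max j)

-- Lists, chains and cycles

module _ {A : Set} where

  lastOf-∈ : (x : A) (xs : List A) → lastOf x xs ∈ x ∷ xs
  lastOf-∈ x []       = here refl
  lastOf-∈ x (y ∷ ys) = there (lastOf-∈ y ys)

  lastOf-++ : (z : A) (xs : List A) (y : A) (ys : List A) → lastOf z (xs ++ y ∷ ys) ≡ lastOf y ys
  lastOf-++ z []       y ys = refl
  lastOf-++ z (x ∷ xs) y ys = lastOf-++ x xs y ys

  rotate-↭ : (as : List A) (x : A) (bs : List A) → as ++ x ∷ bs ↭ x ∷ bs ++ as
  rotate-↭ as x bs = ↭-trans (shift x as bs) (prep x (++-comm as bs))

  Unique-rotate : (as : List A) (x : A) (bs : List A) → Unique (as ++ x ∷ bs) → Unique (bs ++ as)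
  Unique-rotate as x bs u with PermutationSetoid.Unique-resp-↭ (setoid A) (↭⇒↭ₛ (rotate-↭ as x bs)) u
  ... | _ ∷ rotated = rotated

module _ {n : ℕ} where

  pairMate : List (Fin n) → Fin n → Maybe (Fin n)
  pairMate (a ∷ b ∷ r) u = if does (a ≟ u) then just b else if does (b ≟ u) then just a else pairMate r u
  pairMate _           _ = nothing

  pairMate-∈ : (K : List (Fin n)) → ∀ {u w} → pairMate K u ≡ just w → w ∈ K
  pairMate-∈ (a ∷ b ∷ r) {u} uw with a ≟ u
  pairMate-∈ (a ∷ b ∷ r) refl | yes refl = there (here refl)
  ... | no _ with b ≟ u
  pairMate-∈ (a ∷ b ∷ r) refl | no _ | yes refl = here refl
  ... | no _ = there (there (pairMate-∈ r uw))

  pairMate-sym : (K : List (Fin n)) → Unique K → ∀ {u w} → pairMate K u ≡ just w → pairMate K w ≡ just u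
  pairMate-sym (a ∷ b ∷ r) (a∉ ∷ b∉ ∷ uniq) {u} {w} uw with a ≟ u
  ... | yes refl rewrite just-injective (sym uw) | dec-false (a ≟ b) (All.lookup a∉ (here refl))
                       | dec-true (b ≟ b) refl = refl
  ... | no a≢u with b ≟ u
  ... | yes refl rewrite just-injective (sym uw) | dec-true (a ≟ a) refl = refl
  ... | no b≢u rewrite dec-false (a ≟ w) (All.lookup a∉ (there (pairMate-∈ r uw)))
                     | dec-false (b ≟ w) (All.lookup b∉ (pairMate-∈ r uw)) = pairMate-sym r uniq uw

  pairMate-covers : (K : List (Fin n)) (t : ℕ) → length K ≡ t + t →
    ∀ {u} → u ∈ K → pairMate K u ≢ nothing
  pairMate-covers (a ∷ []) zero ()
  pairMate-covers (a ∷ []) (suc t) len with trans (suc-injective len) (+-suc t t)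
  ... | ()
  pairMate-covers (a ∷ b ∷ r) (suc t) len {u} u∈K with a ≟ u
  ... | yes _ = λ ()
  ... | no a≢u with b ≟ u
  ... | yes _ = λ ()
  ... | no b≢u = pairMate-covers r t (suc-injective (trans (suc-injective len) (+-suc t t))) (u∈r u∈K)
    where u∈r : u ∈ a ∷ b ∷ r → u ∈ r
          u∈r (here refl)         = ⊥-elim (a≢u refl)
          u∈r (there (here refl)) = ⊥-elim (b≢u refl)
          u∈r (there (there u∈))  = u∈

module _ {n : ℕ} {G : Graph n} {S : VSet n} where

  chain-tail : {x : Fin n} (xs : List (Fin n)) → Chain G S (x ∷ xs) → Chain G S xs
  chain-tail []       _        = _
  chain-tail (_ ∷ _)  (_ , ch) = ch

  chain-++⁻ˡ : (xs : List (Fin n)) {ys : List (Fin n)} → Chain G S (xs ++ ys) → Chain G S xs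
  chain-++⁻ˡ []           _        = _
  chain-++⁻ˡ (x ∷ [])     _        = _
  chain-++⁻ˡ (x ∷ y ∷ xs) (e , ch) = e , chain-++⁻ˡ (y ∷ xs) ch

  chain-++⁻ʳ : (xs : List (Fin n)) {ys : List (Fin n)} → Chain G S (xs ++ ys) → Chain G S ys
  chain-++⁻ʳ []       ch = ch
  chain-++⁻ʳ (x ∷ xs) ch = chain-++⁻ʳ xs (chain-tail (xs ++ _) ch)

  chain-++⁺ : {x y : Fin n} (xs : List (Fin n)) {ys : List (Fin n)} →
    Chain G S (x ∷ xs) → Chain G S (y ∷ ys) → Edge G S (lastOf x xs) y → Chain G S (x ∷ xs ++ y ∷ ys)
  chain-++⁺ []       _         chy e = e , chy
  chain-++⁺ (x ∷ xs) (e′ , chx) chy e = e′ , chain-++⁺ xs chx chy e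

  chain-rotate : {s : Fin n} {r : List (Fin n)} (as : List (Fin n)) (x : Fin n) (bs : List (Fin n)) →
    s ∷ r ≡ as ++ x ∷ bs → Chain G S (s ∷ r) → Edge G S (lastOf s r) s → Chain G S (bs ++ as)
  chain-rotate [] x bs refl ch _ rewrite ++-identityʳ bs = chain-tail bs ch
  chain-rotate (a ∷ as) x [] refl ch _ = chain-++⁻ˡ (a ∷ as) ch
  chain-rotate (a ∷ as) x (b ∷ bs) refl ch close =
    chain-++⁺ bs (chain-tail (b ∷ bs) (chain-++⁻ʳ (a ∷ as) ch)) (chain-++⁻ˡ (a ∷ as) ch)
      (subst (λ z → Edge G S z a) (lastOf-++ a as x (b ∷ bs)) close)

  chain-inside : {x : Fin n} (xs : List (Fin n)) → Chain G S (x ∷ xs) → S x ≡ true →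
    ∀ {z} → z ∈ x ∷ xs → S z ≡ true
  chain-inside xs       _                  Sx (here refl) = Sx
  chain-inside (y ∷ ys) ((_ , Sy , _) , ch) _  (there z∈) = chain-inside ys ch Sy z∈

  cycle-inside : (c : Cycle G S) → ∀ {z} → z ∈ verts G S c → S z ≡ true
  cycle-inside c = chain-inside (Cycle.rest c) (Cycle.chain c) (proj₁ (proj₂ (Cycle.close c)))

  pairMate-edge : (K : List (Fin n)) → Chain G S K → ∀ {u w} → pairMate K u ≡ just w → Edge G S u w
  pairMate-edge (a ∷ b ∷ r) (ab , ch) {u} uw with a ≟ u
  pairMate-edge (a ∷ b ∷ r) (ab , ch) refl | yes refl = ab
  ... | no _ with b ≟ u
  pairMate-edge (a ∷ b ∷ r) (ab , ch) refl | no _ | yes refl = edge-sym {G = G} {S = S} ab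
  ... | no _ = pairMate-edge r (chain-tail r ch) uw

  pairs-∈ : {a b : Fin n} (L : List (Fin n)) → (a , b) ∈ pairs L → a ∈ L
  pairs-∈ (x ∷ y ∷ ys) (here refl) = here refl
  pairs-∈ (x ∷ y ∷ ys) (there ab∈) = there (pairs-∈ (y ∷ ys) ab∈)

  pairs-∈ʳ : {a b : Fin n} (L : List (Fin n)) → (a , b) ∈ pairs L → b ∈ L
  pairs-∈ʳ (x ∷ y ∷ ys) (here refl) = there (here refl)
  pairs-∈ʳ (x ∷ y ∷ ys) (there ab∈) = there (pairs-∈ʳ (y ∷ ys) ab∈)

  cedges-∈ : (c : Cycle G S) {a b : Fin n} → (a , b) ∈ cedges G S c → a ∈ verts G S c × b ∈ verts G S c
  cedges-∈ c ab∈ with ∈-++⁻ (pairs (verts G S c)) ab∈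
  ... | inj₁ ab∈pairs     = pairs-∈ (verts G S c) ab∈pairs , pairs-∈ʳ (verts G S c) ab∈pairs
  ... | inj₂ (here refl) = lastOf-∈ (Cycle.start c) (Cycle.rest c) , here refl

  cycEdge-∈ : (c : Cycle G S) {a b : Fin n} → CycEdge G S c a b → a ∈ verts G S c
  cycEdge-∈ c (inj₁ ab∈) = proj₁ (cedges-∈ c ab∈)
  cycEdge-∈ c (inj₂ ba∈) = proj₂ (cedges-∈ c ba∈)

  first-edge : (c : Cycle G S) → ∃ λ r₁ → CycEdge G S c (Cycle.start c) r₁
  first-edge c with Cycle.rest c | Cycle.long c
  ... | r₁ ∷ _ | _ = r₁ , inj₁ (here refl)


parity : ∀ m → (∃ λ t → m ≡ t + t) ⊎ (∃ λ t → m ≡ suc (t + t))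
parity zero    = inj₁ (0 , refl)
parity (suc m) with parity m
... | inj₁ (t , m≡t+t)     = inj₂ (t , cong suc m≡t+t)
... | inj₂ (t , m≡1+t+t)   = inj₁ (suc t , cong suc (trans m≡1+t+t (sym (+-suc t t))))

-- Odd cycles and Sachs subgraphs

module _ {n : ℕ} (G : Graph n) (T : VSet n) where

  Inside : List (Fin n) → Set
  Inside xs = ∀ {x} → x ∈ xs → T x ≡ true

  OddCyclesMeet : Set
  OddCyclesMeet = (c d : Cycle G allV) → OddCycle G allV c → OddCycle G allV d →
    Inside (verts G allV c) → Inside (verts G allV d) → ∃ λ x → x ∈ verts G allV c × x ∈ verts G allV d

  private
    chain-within : (xs : List (Fin n)) → Chain G allV xs → Inside xs → Chain G T xs
    chain-within []           _               _  = _
    chain-within (x ∷ [])     _               _  = _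
    chain-within (x ∷ y ∷ ys) ((_ , _ , xy) , ch) xs-in = (xs-in (here refl) , xs-in (there (here refl)) , xy) ,
                                                          chain-within (y ∷ ys) ch (xs-in ∘ there)

    cycle-within : (c : Cycle G allV) → Inside (verts G allV c) → Cycle G T
    cycle-within c c-in = record
      { start = Cycle.start c ; rest = Cycle.rest c ; long = Cycle.long c ; distinct = Cycle.distinct c
      ; chain = chain-within (verts G allV c) (Cycle.chain c) c-in
      ; close = c-in (lastOf-∈ (Cycle.start c) (Cycle.rest c)) , c-in (here refl) , proj₂ (proj₂ (Cycle.close c))
      }

  almostBipartite⇒oddCyclesMeet : AlmostBipartite G T → OddCyclesMeet
  almostBipartite⇒oddCyclesMeet (C , _ , same-as-C) c d c-odd d-odd c-in d-in =
    Cycle.start c , here refl ,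
    cycEdge-∈ d′ (proj₁ (same-as-C d′ d-odd _ _) (proj₂ (same-as-C c′ c-odd _ _) first))
    where
    c′ d′ : Cycle G T
    c′ = cycle-within c c-in
    d′ = cycle-within d d-in
    first : CycEdge G T c′ (Cycle.start c) (proj₁ (first-edge c′))
    first = proj₂ (first-edge c′)

  record OddCycleStartInside (p : Piece G) (u : Fin n) : Set where
    field
      cycle   : Cycle G allV
      piece≡  : p ≡ cycP cycle
      odd     : OddCycle G allV cycle
      inside  : Inside (verts G allV cycle)
      start≡  : u ≡ Cycle.start cycle

  record Pairing (p : Piece G) : Set where
    field
      list   : List (Fin n)
      chain  : Chain G allV list
      unique : Unique list
      even   : ∃ λ t → length list ≡ t + t
      ⊆piece : ∀ {w} → w ∈ list → w ∈ pieceVerts G p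
      missed : ∀ {u} → u ∈ pieceVerts G p → u ∉ list → T u ≡ true → OddCycleStartInside p u

  rotatedPairing : (c : Cycle G allV) (t : ℕ) → length (verts G allV c) ≡ suc (t + t) →
    (as : List (Fin n)) (x : Fin n) (bs : List (Fin n)) → verts G allV c ≡ as ++ x ∷ bs →
    (T x ≡ true → OddCycleStartInside (cycP c) x) → Pairing (cycP c)
  rotatedPairing c t odd as x bs c≡ pivot = record
    { list   = bs ++ as
    ; chain  = chain-rotate as x bs c≡ (Cycle.chain c) (Cycle.close c)
    ; unique = Unique-rotate as x bs (subst Unique c≡ (Cycle.distinct c))
    ; even   = t , suc-injective (trans (sym (trans (cong length c≡) (↭-length rotation))) odd)
    ; ⊆piece = λ {w} w∈ → subst (w ∈_) (sym c≡) (∈-resp-↭ (↭-sym rotation) (there w∈))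
    ; missed = λ u∈ u∉ Tu → pivot-only u∈ u∉ Tu
    }
    where
    rotation : as ++ x ∷ bs ↭ x ∷ bs ++ as
    rotation = rotate-↭ as x bs
    pivot-only : ∀ {u} → u ∈ verts G allV c → u ∉ bs ++ as → T u ≡ true → OddCycleStartInside (cycP c) u
    pivot-only {u} u∈ u∉ Tu with ∈-resp-↭ rotation (subst (u ∈_) c≡ u∈)
    ... | here refl = pivot Tu
    ... | there u∈′ = ⊥-elim (u∉ u∈′)

  cyclePairing : (c : Cycle G allV) → Pairing (cycP c)
  cyclePairing c with parity (length (verts G allV c))
  ... | inj₁ (t , even) = record
    { list = verts G allV c ; chain = Cycle.chain c ; unique = Cycle.distinct c ; even = t , even
    ; ⊆piece = λ w∈ → w∈ ; missed = λ u∈ u∉ → ⊥-elim (u∉ u∈) }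
  ... | inj₂ (t , odd) with Any.any? (λ x → T x ≟ᵇ false) (verts G allV c)
  ... | yes outside =
    let (x , x∈ , Tx) = find outside ; (as , bs , c≡) = ∈-∃++ x∈ in
    rotatedPairing c t odd as x bs c≡ (λ Tx′ → ⊥-elim (not-¬ Tx′ Tx))
  ... | no none = rotatedPairing c t odd [] (Cycle.start c) (Cycle.rest c) refl (λ _ → record
    { cycle = c ; piece≡ = refl ; odd = t , odd ; start≡ = refl
    ; inside = λ x∈ → ¬-not (λ Tx → none (Any.map (λ { refl → Tx }) x∈)) })

  pairing : (p : Piece G) → Pairing p
  pairing (edgeP a b ab) = record
    { list = a ∷ b ∷ [] ; chain = ab , _ ; even = 1 , refl
    ; unique = (edge-≢ {G = G} {S = allV} ab All.∷ All.[]) ∷ All.[] ∷ []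
    ; ⊆piece = λ w∈ → w∈ ; missed = λ u∈ u∉ → ⊥-elim (u∉ u∈) }
  pairing (cycP c) = cyclePairing c

  module _ (sachs : HasSachs G) where

    private
      pieces : List (Piece G)
      pieces = proj₁ sachs

      pieceOf : Fin n → Fin (length pieces)
      pieceOf v = proj₁ (proj₂ sachs v)

      piece : Fin n → Piece G
      piece v = lookup pieces (pieceOf v)

      in-piece : ∀ v → v ∈ pieceVerts G (piece v)
      in-piece v = proj₁ (proj₂ (proj₂ sachs v))

      pieceOf-unique : ∀ {v} j → v ∈ pieceVerts G (lookup pieces j) → j ≡ pieceOf v
      pieceOf-unique {v} = proj₂ (proj₂ (proj₂ sachs v))

      pairs-of : Fin n → List (Fin n)
      pairs-of v = Pairing.list (pairing (piece v))

    sachsMatching : Matching G allV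
    sachsMatching = record { mate = λ v → pairMate (pairs-of v) v ; valid = sachs-valid }
      where
      sachs-valid : ∀ u w → pairMate (pairs-of u) u ≡ just w →
        Edge G allV u w × (pairMate (pairs-of w) w ≡ just u)
      sachs-valid u w uw = pairMate-edge (pairs-of u) (Pairing.chain P) uw
                         , subst (λ j → pairMate (Pairing.list (pairing (lookup pieces j))) w ≡ just u)
                                 (pieceOf-unique (pieceOf u) (Pairing.⊆piece P (pairMate-∈ (pairs-of u) uw)))
                                 (pairMate-sym (pairs-of u) (Pairing.unique P) uw)
        where P = pairing (piece u)

    sachsMatching-exposed : ∀ {v} → T v ≡ true → Matching.mate sachsMatching v ≡ nothing →
      OddCycleStartInside (piece v) v
    sachsMatching-exposed {v} Tv free =
      Pairing.missed P (in-piece v) (λ v∈ → pairMate-covers (pairs-of v) t even v∈ free) Tv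
      where
      P = pairing (piece v)
      t = proj₁ (Pairing.even P)
      even = proj₂ (Pairing.even P)

    sachsMatching-exposes-≤1 : OddCyclesMeet → ∀ {u v} → T u ≡ true → T v ≡ true →
      Matching.mate sachsMatching u ≡ nothing → Matching.mate sachsMatching v ≡ nothing → u ≡ v
    sachsMatching-exposes-≤1 meet {u} {v} Tu Tv u-free v-free =
      trans U.start≡ (trans (cong Cycle.start same-cycle) (sym V.start≡))
      where
      module U = OddCycleStartInside (sachsMatching-exposed Tu u-free)
      module V = OddCycleStartInside (sachsMatching-exposed Tv v-free)
      x = proj₁ (meet U.cycle V.cycle U.odd V.odd U.inside V.inside)
      x∈U = proj₁ (proj₂ (meet U.cycle V.cycle U.odd V.odd U.inside V.inside))
      x∈V = proj₂ (proj₂ (meet U.cycle V.cycle U.odd V.odd U.inside V.inside))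
      same-piece : pieceOf u ≡ pieceOf v
      same-piece = trans (pieceOf-unique (pieceOf u) (subst (λ p → x ∈ pieceVerts G p) (sym U.piece≡) x∈U))
                    (sym (pieceOf-unique (pieceOf v) (subst (λ p → x ∈ pieceVerts G p) (sym V.piece≡) x∈V)))
      cycP-injective : ∀ {c d} → cycP {G = G} c ≡ cycP d → c ≡ d
      cycP-injective refl = refl
      same-cycle : U.cycle ≡ V.cycle
      same-cycle = cycP-injective (trans (sym U.piece≡) (trans (cong (lookup pieces) same-piece) V.piece≡))

  sachs⇒uncovered≤1 : HasSachs G → OddCyclesMeet → BoundaryAvoidsD G T →
    {P : Matching G T} → IsMaximum G T P → uncovered G T P ≤ 1
  sachs⇒uncovered≤1 sachs meet boundary∉D {P} P-max = begin
    uncovered G T P         ≤⟨ uncovered≤exposed∩ M boundary∉D {P} P-max ⟩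
    countB (exposed M ∩ T)  ≤⟨ countB-subsingleton exposed-unique ⟩
    1                       ∎
    where
    open ≤-Reasoning
    M : Matching G allV
    M = sachsMatching sachs
    exposed-unique : ∀ u v → (exposed M ∩ T) u ≡ true → (exposed M ∩ T) v ≡ true → u ≡ v
    exposed-unique u v Eu Ev =
      let (Mu , Tu) = ∧-true⁻ Eu ; (Mv , Tv) = ∧-true⁻ Ev in
      sachsMatching-exposes-≤1 sachs meet Tu Tv (proj₂ (exposed⁻ M Mu)) (proj₂ (exposed⁻ M Mv))

-- BAB-graphs

module _ {n : ℕ} {G : Graph n} {S : VSet n} where

  flower-uncovered : {M : Matching G S} {C : Cycle G S} {v : Fin n} → FlowerAt G S M C v → 1 ≤ uncovered G S M
  flower-uncovered {M} F = countB-pos (lastOf base path) (exposed⁺ M stem-end-inside (Stem.endFree stem))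
    where
    open FlowerAt F
    path = Stem.path stem
    stem-end-inside : S (lastOf base path) ≡ true
    stem-end-inside = chain-inside path (Stem.chain stem) (cycle-inside blossom (proj₁ isBase)) (lastOf-∈ base path)

module _ {n k : ℕ} {G : Graph n} {part : Fin n → Maybe (Fin k)} (bab : IsBAB G k part) where

  open IsBAB bab

  bab-separated : Separated part {G}
  bab-separated u v uv u≁v = by-part (part u) refl
    where
    by-part : ∀ j → part u ≡ j → ¬ InD G (partOf part j) u
    by-part nothing  pu = [ proj₁ ∘ proj₂ , proj₁ ∘ proj₂ ]′ (crossB u v uv u≁v pu)
    by-part (just i) pu = proj₁ (proj₂ (crossG u v uv u≁v i pu))

  module _ (i : Fin k) where

    private
      Gᵢ : VSet n
      Gᵢ = partG part i
      Cᵢ : Cycle G Gᵢ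
      Cᵢ = proj₁ (almostB i)
      flower = flowers i (Cycle.start Cᵢ) (cycle-inside Cᵢ (here refl))

    flowerMatching : Matching G Gᵢ
    flowerMatching = proj₁ flower

    flowerMatching-max : IsMaximum G Gᵢ flowerMatching
    flowerMatching-max = proj₁ (proj₂ flower)

    flowerMatching-uncovered : HasSachs G → uncovered G Gᵢ flowerMatching ≡ 1
    flowerMatching-uncovered sachs = ≤-antisym
      (sachs⇒uncovered≤1 G Gᵢ sachs (almostBipartite⇒oddCyclesMeet G Gᵢ (almostB i))
        (separated⇒boundaryAvoidsD part bab-separated (just i)) {flowerMatching} flowerMatching-max)
      (flower-uncovered (proj₂ (proj₂ flower)))

mainTheorem9 : ∀ {n k : ℕ} (G : Graph n) (part : Fin n → Maybe (Fin k)) →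
    IsBAB G k part → HasSachs G →
    ∀ (dG dB : ℕ) → HasDef G allV dG → HasDef G (partB part) dB →
    dG ≡ dB + k
mainTheorem9 {n} {k} G part bab sachs _ _ (M , M-max , refl) (MB , MB-max , refl) = begin
  uncovered G allV M
    ≡⟨ uncovered-additive part (bab-separated bab) M M-max parts parts-max ⟩
  uncovered G (partB part) MB + ∑[ i < k ] uncovered G (partG part i) (flowerMatching bab i)
    ≡⟨ cong (uncovered G (partB part) MB +_) (sum-cong-≗ (λ i → flowerMatching-uncovered bab i sachs)) ⟩
  uncovered G (partB part) MB + ∑[ i < k ] 1
    ≡⟨ cong (uncovered G (partB part) MB +_) (∑-ones k) ⟩
  uncovered G (partB part) MB + k ∎
  where
  open ≡-Reasoning
  parts : (j : Maybe (Fin k)) → Matching G (partOf part j)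
  parts nothing  = MB
  parts (just i) = flowerMatching bab i
  parts-max : ∀ j → IsMaximum G (partOf part j) (parts j)
  parts-max nothing  = MB-max
  parts-max (just i) = flowerMatching-max bab i
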